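{- $\mathbf{Int}$ is a $*$-autonomous category. (In particular, $\mathbf{Int}$ is symmetric monoidal closed.)
   Context: An interface $X$ is a pair $(|X|,P_X)$ where $|X|$ is a set and $P_X:\mathcal{P}(|X|)\to\mathcal{P}(|X|)$ is a monotonic predicate transformer. A seed of $X$ is a subset $x\subseteq|X|$ with $x\subseteq P_X(x)$; $\mathrm{Sd}(X)$ denotes the set of seeds. For a relation $r\subseteq A\times B$, $\langle r\rangle(x)=\{b\mid \exists a\,(a,b)\in r\wedge a\in x\}$ and $r^\sim$ is the converse relation; $\overline{x}$ denotes complement. The dual is $X^\perp=(|X|,P_X^\perp)$ with $P_X^\perp(x)=\overline{P_X(\overline{x})}$. The tensor is $X\otimes Y=(|X|\times|Y|,P_X\otimes P_Y)$ with $(P_X\otimes P_Y)(r)=\bigcup_{x\times y\subseteq r}P_X(x)\times P_Y(y)$. The par is $X\mathbin{\text{⅋}}Y=(X^\perp\otimes Y^\perp)^\perp$, and $X\multimap Y=X^\perp\mathbin{\text{⅋}}Y$. The units are $\mathbf{1}=(\{*\},\mathrm{Id})$ and $\bot=\mathbf{1}^\perp$. $\mathbf{Int}$ is the category whose objects are interfaces and whose morphisms from $X$ to $Y$ are the seeds of $X\multimap Y$ (linear arrows), with relational composition and identities $\mathrm{Id}_{|X|}$; the duality $(\cdot)^\perp$ acts on morphisms by $r\mapsto r^\sim$. -}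

module Defs where

open import Level using (Level; _⊔_; 0ℓ; Lift; lift) renaming (suc to lsuc)
open import Data.Product using (Σ; ∃; ∃-syntax; _×_; _,_; proj₁; proj₂)
open import Relation.Nullary using (¬_)
open import Data.Unit using (⊤; tt)
open import Relation.Binary.Core using (Rel)
open import Relation.Binary.Structures using (IsEquivalence)
open import Relation.Binary.PropositionalEquality using (_≡_; refl; sym; trans; subst)

record Category (o m e : Level) : Set (lsuc (o ⊔ m ⊔ e)) where
  infix  4 _≈_
  infixr 9 _∘_
  field
    Obj      : Set o
    _⇒_      : Obj → Obj → Set m
    _≈_      : ∀ {A B} → Rel (A ⇒ B) e
    id       : ∀ {A} → A ⇒ A
    _∘_      : ∀ {A B C} → B ⇒ C → A ⇒ B → A ⇒ C
    ≈-equiv  : ∀ {A B} → IsEquivalence (_≈_ {A} {B})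
    ∘-resp-≈ : ∀ {A B C} {f h : B ⇒ C} {g i : A ⇒ B} →
               f ≈ h → g ≈ i → f ∘ g ≈ h ∘ i
    assoc     : ∀ {A B C D} {f : A ⇒ B} {g : B ⇒ C} {h : C ⇒ D} →
                (h ∘ g) ∘ f ≈ h ∘ (g ∘ f)
    identityˡ : ∀ {A B} {f : A ⇒ B} → id ∘ f ≈ f
    identityʳ : ∀ {A B} {f : A ⇒ B} → f ∘ id ≈ f

module _ {o m e} (C : Category o m e) where
  open Category C

  record IsIso {A B : Obj} (f : A ⇒ B) : Set (m ⊔ e) where
    field
      inv  : B ⇒ A
      isoˡ : inv ∘ f ≈ id
      isoʳ : f ∘ inv ≈ id

  record SymmetricMonoidalClosed
           (_⊗₀_ : Obj → Obj → Obj) (I : Obj) (_⊸₀_ : Obj → Obj → Obj)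
           : Set (o ⊔ m ⊔ e) where
    infixr 10 _⊗₁_
    field
      _⊗₁_     : ∀ {A B X Y} → A ⇒ B → X ⇒ Y → (A ⊗₀ X) ⇒ (B ⊗₀ Y)
      ⊗-resp-≈ : ∀ {A B X Y} {f f′ : A ⇒ B} {g g′ : X ⇒ Y} →
                 f ≈ f′ → g ≈ g′ → f ⊗₁ g ≈ f′ ⊗₁ g′
      ⊗-id     : ∀ {A X} → id {A} ⊗₁ id {X} ≈ id
      ⊗-∘      : ∀ {A B D X Y Z} {f : B ⇒ D} {g : A ⇒ B} {h : Y ⇒ Z} {k : X ⇒ Y} →
                 (f ∘ g) ⊗₁ (h ∘ k) ≈ (f ⊗₁ h) ∘ (g ⊗₁ k)
      α⇒ : ∀ {A B X} → ((A ⊗₀ B) ⊗₀ X) ⇒ (A ⊗₀ (B ⊗₀ X))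
      λ⇒ : ∀ {A} → (I ⊗₀ A) ⇒ A
      ρ⇒ : ∀ {A} → (A ⊗₀ I) ⇒ A
      σ  : ∀ {A B} → (A ⊗₀ B) ⇒ (B ⊗₀ A)
      α-iso : ∀ {A B X} → IsIso (α⇒ {A} {B} {X})
      λ-iso : ∀ {A} → IsIso (λ⇒ {A})
      ρ-iso : ∀ {A} → IsIso (ρ⇒ {A})
      σ-invol : ∀ {A B} → σ {B} {A} ∘ σ {A} {B} ≈ id
      α-natural : ∀ {A B X A′ B′ X′} {f : A ⇒ A′} {g : B ⇒ B′} {h : X ⇒ X′} →
                  α⇒ ∘ ((f ⊗₁ g) ⊗₁ h) ≈ (f ⊗₁ (g ⊗₁ h)) ∘ α⇒
      λ-natural : ∀ {A B} {f : A ⇒ B} → λ⇒ ∘ (id ⊗₁ f) ≈ f ∘ λ⇒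
      ρ-natural : ∀ {A B} {f : A ⇒ B} → ρ⇒ ∘ (f ⊗₁ id) ≈ f ∘ ρ⇒
      σ-natural : ∀ {A B X Y} {f : A ⇒ B} {g : X ⇒ Y} →
                  σ ∘ (f ⊗₁ g) ≈ (g ⊗₁ f) ∘ σ
      pentagon : ∀ {A B X Y} →
                 (id {A} ⊗₁ α⇒ {B} {X} {Y}) ∘ α⇒ ∘ (α⇒ ⊗₁ id) ≈ α⇒ ∘ α⇒
      triangle : ∀ {A B} → (id {A} ⊗₁ λ⇒ {B}) ∘ α⇒ ≈ ρ⇒ ⊗₁ id
      hexagon  : ∀ {A B X} →
                 α⇒ {B} {X} {A} ∘ σ ∘ α⇒ ≈ (id ⊗₁ σ) ∘ α⇒ ∘ (σ ⊗₁ id)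
      -- closedness: (− ⊗₀ B) ⊣ (B ⊸₀ −), as a universal arrow
      ev          : ∀ {B X} → ((B ⊸₀ X) ⊗₀ B) ⇒ X
      curry       : ∀ {A B X} → (A ⊗₀ B) ⇒ X → A ⇒ (B ⊸₀ X)
      curry-resp-≈ : ∀ {A B X} {f g : (A ⊗₀ B) ⇒ X} → f ≈ g → curry f ≈ curry g
      curry-β     : ∀ {A B X} {f : (A ⊗₀ B) ⇒ X} → ev ∘ (curry f ⊗₁ id) ≈ f
      curry-η     : ∀ {A B X} {g : A ⇒ (B ⊸₀ X)} → curry (ev ∘ (g ⊗₁ id)) ≈ g

  record StarAutonomous
           (_⊗₀_ : Obj → Obj → Obj) (I : Obj) (_⊸₀_ : Obj → Obj → Obj) (⊥₀ : Obj)
           : Set (o ⊔ m ⊔ e) where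
    field
      smc : SymmetricMonoidalClosed _⊗₀_ I _⊸₀_
    open SymmetricMonoidalClosed smc
    field
      dualizing : ∀ {A} → IsIso (curry {A} {A ⊸₀ ⊥₀} {⊥₀} (ev ∘ σ))

-- subsets of a set (level 0); predicate transformers land in Set₁ since
-- the tensor quantifies over subsets.
Subset : Set → Set₁
Subset A = A → Set

_⊆_ : ∀ {A : Set} {ℓ ℓ′} → (A → Set ℓ) → (A → Set ℓ′) → Set (ℓ ⊔ ℓ′)
x ⊆ y = ∀ a → x a → y a

∁ : ∀ {A : Set} → Subset A → Subset A
∁ x a = ¬ x a

record Interface : Set₂ where
  field
    ∣_∣  : Set
    P    : Subset ∣_∣ → (∣_∣ → Set₁)
    mono : ∀ {x y} → x ⊆ y → P x ⊆ P y
open Interface public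

Seed : (X : Interface) → Subset ∣ X ∣ → Set₁
Seed X x = x ⊆ P X x

_^⊥ : Interface → Interface
X ^⊥ = record
  { ∣_∣  = ∣ X ∣
  ; P    = λ x a → ¬ P X (∁ x) a
  ; mono = λ {x} {y} x⊆y a ¬Px p →
             ¬Px (mono X (λ b ¬yb xb → ¬yb (x⊆y b xb)) a p)
  }

_⊗_ : Interface → Interface → Interface
X ⊗ Y = record
  { ∣_∣  = ∣ X ∣ × ∣ Y ∣
  ; P    = λ r ab → ∃[ x ] ∃[ y ]
             ((∀ a b → x a → y b → r (a , b)) × P X x (proj₁ ab) × P Y y (proj₂ ab))
  ; mono = λ r⊆s ab → λ { (x , y , inc , px , py) →
             x , y , (λ a b xa yb → r⊆s (a , b) (inc a b xa yb)) , px , py }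
  }

_⅋_ : Interface → Interface → Interface
X ⅋ Y = ((X ^⊥) ⊗ (Y ^⊥)) ^⊥

_⊸_ : Interface → Interface → Interface
X ⊸ Y = (X ^⊥) ⅋ Y

𝟏 : Interface
𝟏 = record
  { ∣_∣  = ⊤
  ; P    = λ x a → Lift (lsuc 0ℓ) (x a)
  ; mono = λ x⊆y a → λ { (lift p) → lift (x⊆y a p) }
  }

⊥ᴵ : Interface
⊥ᴵ = 𝟏 ^⊥

Relation : Interface → Interface → Set₁
Relation X Y = Subset (∣ X ∣ × ∣ Y ∣)

IdRel : (X : Interface) → Relation X X
IdRel X (a , b) = a ≡ b

-- relational composition  s · r  (first r, then s)
_·_ : ∀ {X Y Z} → Relation Y Z → Relation X Y → Relation X Z
_·_ {Y = Y} s r (a , c) = ∃[ b ] (r (a , b) × s (b , c))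

record LinArrow (X Y : Interface) : Set₁ where
  constructor linArrow
  field
    rel  : Relation X Y
    seed : Seed (X ⊸ Y) rel
open LinArrow public

_≈ᴵ_ : ∀ {X Y} → LinArrow X Y → LinArrow X Y → Set
f ≈ᴵ g = (rel f ⊆ rel g) × (rel g ⊆ rel f)

-- The facts that make Int a category: identities and composites of linear
-- arrows are linear arrows (these are part of the claim, not assumed).
record IntIsCategory : Set₂ where
  field
    id-seed : ∀ X → Seed (X ⊸ X) (IdRel X)
    ·-seed  : ∀ {X Y Z} (s : Relation Y Z) (r : Relation X Y) →
              Seed (Y ⊸ Z) s → Seed (X ⊸ Y) r → Seed (X ⊸ Z) (_·_ {X} {Y} {Z} s r)

Int : IntIsCategory → Category (lsuc (lsuc 0ℓ)) (lsuc 0ℓ) 0ℓ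
Int H = record
  { Obj = Interface
  ; _⇒_ = LinArrow
  ; _≈_ = _≈ᴵ_
  ; id  = λ {X} → linArrow (IdRel X) (id-seed X)
  ; _∘_ = λ {X} {Y} {Z} g f →
      linArrow (_·_ {X} {Y} {Z} (rel g) (rel f))
               (·-seed {X} {Y} {Z} (rel g) (rel f) (seed g) (seed f))
  ; ≈-equiv = record
      { refl  = (λ _ p → p) , (λ _ p → p)
      ; sym   = λ { (p , q) → q , p }
      ; trans = λ { (p , q) (p′ , q′) → (λ a z → p′ a (p a z)) , (λ a z → q a (q′ a z)) }
      }
  ; ∘-resp-≈ = λ { (p , q) (p′ , q′) →
      (λ { _ (b , r , s) → b , p′ _ r , p _ s }) ,
      (λ { _ (b , r , s) → b , q′ _ r , q _ s }) }
  ; assoc = (λ { _ (b , r1 , c , r2 , r3) → c , (b , r1 , r2) , r3 }) ,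
            (λ { _ (c , (b , r1 , r2) , r3) → b , r1 , c , r2 , r3 })
  ; identityˡ = (λ { _ (b , r , refl) → r }) , (λ { (a , b) r → b , r , refl })
  ; identityʳ = (λ { _ (b , refl , r) → r }) , (λ { (a , b) r → a , refl , r })
  }
  where open IntIsCategory H

-- Under excluded middle, r is a seed of X ⊸ Y exactly when it is a
-- simulation: whenever a ∈ P_X u and (a, b) ∈ r, then b ∈ P_Y ⟨r⟩u.
-- Simulations contain the identities and are closed under composition and
-- tensor, which makes Int a category and ⊗ a bifunctor.  The structure maps
-- (associator, unitors, symmetry, evaluation) are simulations, and since
-- all of them are graphs of the corresponding bijections of carriers, the
-- coherence laws are those of sets and relations.  For the dualizing object
-- ⊥, the inverse of A → (A ⊸ ⊥) ⊸ ⊥ is the graph of the projection; that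
-- it is a simulation is a second argument by contradiction.
module Submission where

open import Defs
open import Level using (0ℓ; lift) renaming (suc to lsuc)
open import Data.Product using (Σ-syntax; ∃-syntax; _×_; _,_; proj₁; proj₂; swap; assocʳ′; assocˡ′)
open import Data.Unit using (⊤; tt)
open import Function using (_∘′_)
open import Relation.Nullary using (¬_)
open import Relation.Nullary.Decidable using (decidable-stable)
open import Relation.Binary.PropositionalEquality using (_≡_; refl; sym)
open import Axiom.ExcludedMiddle using (ExcludedMiddle)

⟨_⟩ : {A B : Set} → (A × B → Set) → Subset A → Subset B
⟨ r ⟩ u b = ∃[ a ] (u a × r (a , b))

graph : {A B : Set} → (A → B) → (A × B → Set)
graph f (a , b) = f a ≡ b

_⊗ʳ_ : {A B X Y : Set} → (A × B → Set) → (X × Y → Set) → ((A × X) × (B × Y) → Set)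
(r ⊗ʳ s) ((a , x) , (b , y)) = r (a , b) × s (x , y)

curryʳ : {A B X : Set} → ((A × B) × X → Set) → (A × (B × X) → Set)
curryʳ r (a , (b , x)) = r ((a , b) , x)

evalʳ : {B X : Set} → ((B × X) × B) × X → Set
evalʳ (((b , x) , b′) , x′) = (b ≡ b′) × (x ≡ x′)

record IsSimulation (X Y : Interface) (r : Relation X Y) : Set₁ where
  constructor simulation
  field
    simulates : ∀ {u a b} → P X u a → r (a , b) → P Y (⟨ r ⟩ u) b
open IsSimulation

id-simulation : ∀ X → IsSimulation X X (IdRel X)
id-simulation X = simulation λ { {a = a} pu refl → mono X (λ a′ ua′ → a′ , ua′ , refl) a pu }

·-simulation : ∀ {X Y Z} {s : Relation Y Z} {r : Relation X Y} →
               IsSimulation Y Z s → IsSimulation X Y r →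
               IsSimulation X Z (_·_ {X} {Y} {Z} s r)
·-simulation {Z = Z} s-sim r-sim = simulation λ { {b = c} pu (b , rab , sbc) →
  mono Z (λ { c′ (b′ , (a′ , ua′ , rab′) , sbc′) → a′ , ua′ , b′ , rab′ , sbc′ }) c
    (simulates s-sim (simulates r-sim pu rab) sbc) }

⊗-simulation : ∀ {A B X Y} {r : Relation A B} {s : Relation X Y} →
               IsSimulation A B r → IsSimulation X Y s →
               IsSimulation (A ⊗ X) (B ⊗ Y) (r ⊗ʳ s)
⊗-simulation r-sim s-sim = simulation λ { (v , w , v×w⊆u , pv , pw) (rab , sxy) →
  ⟨ _ ⟩ v , ⟨ _ ⟩ w ,
  (λ { b y (a , va , rab′) (x , wx , sxy′) → (a , x) , v×w⊆u a x va wx , rab′ , sxy′ }) ,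
  simulates r-sim pv rab , simulates s-sim pw sxy }

graph-simulation : ∀ {X Y} {f : ∣ X ∣ → ∣ Y ∣} →
                   (∀ {u a} → P X u a → P Y (⟨ graph f ⟩ u) (f a)) →
                   IsSimulation X Y (graph f)
graph-simulation preserves = simulation λ { pu refl → preserves pu }

graph-inverse : ∀ {X Y} (f : ∣ X ∣ → ∣ Y ∣) (g : ∣ Y ∣ → ∣ X ∣) → (∀ a → g (f a) ≡ a) →
                (_·_ {X} {Y} {X} (graph g) (graph f) ⊆ IdRel X) ×
                (IdRel X ⊆ _·_ {X} {Y} {X} (graph g) (graph f))
graph-inverse f g g∘f≡id =
  (λ { (a , _) (_ , refl , refl) → sym (g∘f≡id a) }) ,
  (λ { (a , _) refl → f a , refl , g∘f≡id a })

module _ {A B C : Interface} where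

  assocʳ-simulation : IsSimulation ((A ⊗ B) ⊗ C) (A ⊗ (B ⊗ C)) (graph assocʳ′)
  assocʳ-simulation = graph-simulation λ { (w , z , w×z⊆u , (x , y , x×y⊆w , px , py) , pz) →
    x , (λ { (b , c) → y b × z c }) ,
    (λ { a (b , c) xa (yb , zc) → ((a , b) , c) , w×z⊆u (a , b) c (x×y⊆w a b xa yb) zc , refl }) ,
    px , (y , z , (λ _ _ yb zc → yb , zc) , py , pz) }

  assocˡ-simulation : IsSimulation (A ⊗ (B ⊗ C)) ((A ⊗ B) ⊗ C) (graph assocˡ′)
  assocˡ-simulation = graph-simulation λ { (x , w , x×w⊆u , px , (y , z , y×z⊆w , py , pz)) →
    (λ { (a , b) → x a × y b }) , z ,
    (λ { (a , b) c (xa , yb) zc → (a , (b , c)) , x×w⊆u a (b , c) xa (y×z⊆w b c yb zc) , refl }) ,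
    (x , y , (λ _ _ xa yb → xa , yb) , px , py) , pz }

module _ {A B : Interface} where

  swap-simulation : IsSimulation (A ⊗ B) (B ⊗ A) (graph swap)
  swap-simulation = graph-simulation λ { (x , y , x×y⊆u , px , py) →
    y , x , (λ b a yb xa → (a , b) , x×y⊆u a b xa yb , refl) , py , px }

module _ {A : Interface} where

  unitˡ-simulation : IsSimulation (𝟏 ⊗ A) A (graph proj₂)
  unitˡ-simulation = graph-simulation λ { {a = t , a} (x , y , x×y⊆u , lift xt , py) →
    mono A (λ a′ ya′ → (t , a′) , x×y⊆u t a′ xt ya′ , refl) a py }

  unitˡ⁻¹-simulation : IsSimulation A (𝟏 ⊗ A) (graph (tt ,_))
  unitˡ⁻¹-simulation = graph-simulation λ pu →
    (λ _ → ⊤) , _ , (λ _ a′ _ ua′ → a′ , ua′ , refl) , lift tt , pu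

  unitʳ-simulation : IsSimulation (A ⊗ 𝟏) A (graph proj₁)
  unitʳ-simulation = graph-simulation λ { {a = a , t} (x , y , x×y⊆u , px , lift yt) →
    mono A (λ a′ xa′ → (a′ , t) , x×y⊆u a′ t xa′ yt , refl) a px }

  unitʳ⁻¹-simulation : IsSimulation A (A ⊗ 𝟏) (graph (_, tt))
  unitʳ⁻¹-simulation = graph-simulation λ pu →
    _ , (λ _ → ⊤) , (λ a′ _ ua′ _ → a′ , ua′ , refl) , pu , lift tt

module Classical (em₀ : ExcludedMiddle 0ℓ) (em₁ : ExcludedMiddle (lsuc 0ℓ)) where

  ∁∁⊆ : {A : Set} (x : Subset A) → ∁ (∁ x) ⊆ x
  ∁∁⊆ x a = decidable-stable em₀

  ¬¬-elim₁ : {Q : Set₁} → ¬ ¬ Q → Q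
  ¬¬-elim₁ = decidable-stable em₁

  -- A counterexample to P_{X ⊸ Y} r (a, b) is a pair (x, y) with x × y
  -- disjoint from r, a ∈ P_X x and b ∉ P_Y (∁ y); take x = u, y = ∁ ⟨r⟩u.
  P⊸⇒simulates : ∀ X Y (r : Relation X Y) {a b} → P (X ⊸ Y) r (a , b) →
                 ∀ {u} → P X u a → P Y (⟨ r ⟩ u) b
  P⊸⇒simulates X Y r {a} {b} p⊸ {u} pu = ¬¬-elim₁ λ ¬p → p⊸
    ( u , ∁ (⟨ r ⟩ u)
    , (λ a′ b′ ua′ ∉⟨r⟩u rab′ → ∉⟨r⟩u (a′ , ua′ , rab′))
    , (λ ¬p∁∁ → ¬p∁∁ (mono X (λ a′ ua′ ∉u → ∉u ua′) a pu))
    , (λ p∁∁ → ¬p (mono Y (∁∁⊆ (⟨ r ⟩ u)) b p∁∁)) )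

  simulates⇒P⊸ : ∀ X Y (r : Relation X Y) {a b} →
                 (∀ {u} → P X u a → P Y (⟨ r ⟩ u) b) → P (X ⊸ Y) r (a , b)
  simulates⇒P⊸ X Y r {a} {b} simulates (x , y , x×y⊆∁r , ¬¬px , ¬p∁y) =
    ¬p∁y (mono Y ⟨r⟩x⊆∁y b (simulates (mono X (∁∁⊆ x) a (¬¬-elim₁ ¬¬px))))
    where
    ⟨r⟩x⊆∁y : ⟨ r ⟩ x ⊆ ∁ y
    ⟨r⟩x⊆∁y b′ (a′ , xa′ , rab′) yb′ = x×y⊆∁r a′ b′ xa′ yb′ rab′

  seed⇒simulation : ∀ {X Y} {r : Relation X Y} → Seed (X ⊸ Y) r → IsSimulation X Y r
  seed⇒simulation {X} {Y} {r} seed-r = simulation λ pu rab → P⊸⇒simulates X Y r (seed-r _ rab) pu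

  simulation⇒seed : ∀ {X Y} {r : Relation X Y} → IsSimulation X Y r → Seed (X ⊸ Y) r
  simulation⇒seed {X} {Y} {r} r-sim _ rab = simulates⇒P⊸ X Y r λ pu → simulates r-sim pu rab

  Int-isCategory : IntIsCategory
  Int-isCategory = record
    { id-seed = λ X → simulation⇒seed (id-simulation X)
    ; ·-seed  = λ {X} {Y} {Z} _ _ seed-s seed-r → simulation⇒seed
        (·-simulation (seed⇒simulation {Y} {Z} seed-s) (seed⇒simulation {X} {Y} seed-r))
    }

  open Category (Int Int-isCategory)

  simulation⇒arrow : ∀ {X Y} {r : Relation X Y} → IsSimulation X Y r → X ⇒ Y
  simulation⇒arrow {r = r} r-sim = linArrow r (simulation⇒seed r-sim)

  arrow⇒simulation : ∀ {X Y} (f : X ⇒ Y) → IsSimulation X Y (rel f)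
  arrow⇒simulation f = seed⇒simulation (seed f)

  graph-iso : ∀ {X Y} {f : ∣ X ∣ → ∣ Y ∣} {g : ∣ Y ∣ → ∣ X ∣}
              (f-sim : IsSimulation X Y (graph f)) (g-sim : IsSimulation Y X (graph g)) →
              (∀ a → g (f a) ≡ a) → (∀ b → f (g b) ≡ b) →
              IsIso (Int Int-isCategory) (simulation⇒arrow f-sim)
  graph-iso {X} {Y} {f} {g} _ g-sim g∘f≡id f∘g≡id = record
    { inv  = simulation⇒arrow g-sim
    ; isoˡ = graph-inverse {X} {Y} f g g∘f≡id
    ; isoʳ = graph-inverse {Y} {X} g f f∘g≡id
    }

  assoc⇒ : ∀ {A B C} → ((A ⊗ B) ⊗ C) ⇒ (A ⊗ (B ⊗ C))
  assoc⇒ {A} {B} {C} = simulation⇒arrow (assocʳ-simulation {A} {B} {C})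

  unitˡ⇒ : ∀ {A} → (𝟏 ⊗ A) ⇒ A
  unitˡ⇒ = simulation⇒arrow unitˡ-simulation

  unitʳ⇒ : ∀ {A} → (A ⊗ 𝟏) ⇒ A
  unitʳ⇒ = simulation⇒arrow unitʳ-simulation

  swap⇒ : ∀ {A B} → (A ⊗ B) ⇒ (B ⊗ A)
  swap⇒ {A} {B} = simulation⇒arrow (swap-simulation {A} {B})

  _⊗⇒_ : ∀ {A B X Y} → A ⇒ B → X ⇒ Y → (A ⊗ X) ⇒ (B ⊗ Y)
  f ⊗⇒ g = simulation⇒arrow (⊗-simulation (arrow⇒simulation f) (arrow⇒simulation g))

  eval⇒ : ∀ {B X} → ((B ⊸ X) ⊗ B) ⇒ X
  eval⇒ {B} {X} = simulation⇒arrow {r = evalʳ} (simulation λ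
    { (w , v , w×v⊆u , pw , pv) (refl , refl) →
        mono X (λ { x′ (b′ , vb′ , wb′x′) → ((b′ , x′) , b′) , w×v⊆u (b′ , x′) b′ wb′x′ vb′ , refl , refl }) _
          (P⊸⇒simulates B X w pw pv) })

  curry⇒ : ∀ {A B X} → (A ⊗ B) ⇒ X → A ⇒ (B ⊸ X)
  curry⇒ {A} {B} {X} f = simulation⇒arrow {r = curryʳ (rel f)} (simulation λ {u} pu rabx →
    simulates⇒P⊸ B X (⟨ curryʳ (rel f) ⟩ u) λ {w} pw →
      mono X (λ { x′ ((a′ , b′) , (ua′ , wb′) , rabx′) → b′ , wb′ , a′ , ua′ , rabx′ }) _
        (simulates (arrow⇒simulation f) (u , w , (λ _ _ ua′ wb′ → ua′ , wb′) , pu , pw) rabx))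

  -- Suppose a ∉ P_A s, where s = ⟨π⟩u.  Then W = {(a′, *) | a′ ∉ s} is
  -- P_{A ⊸ ⊥} at (a, *), since otherwise some v ⊆ s would have a ∈ P_A v;
  -- simulating u against W then produces an element of W whose image lies in s.
  bidual-projection-simulation : ∀ {A} →
    IsSimulation ((A ⊸ ⊥ᴵ) ⊸ ⊥ᴵ) A (graph (proj₁ ∘′ proj₁))
  bidual-projection-simulation {A} = graph-simulation λ { {u} {(a , _) , t} pu →
    ¬¬-elim₁ λ a∉Ps → P⊸⇒simulates (A ⊸ ⊥ᴵ) ⊥ᴵ u pu (W-at a u a∉Ps)
      (lift λ { (q′ , q′∈W , uq′t) → q′∈W ((q′ , t) , uq′t , refl) }) }
    where
    W : Subset ∣ (A ⊸ ⊥ᴵ) ⊸ ⊥ᴵ ∣ → Subset ∣ A ⊸ ⊥ᴵ ∣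
    W u (a′ , _) = ¬ ⟨ graph (proj₁ ∘′ proj₁) ⟩ u a′
    W-at : ∀ a u → ¬ P A (⟨ graph (proj₁ ∘′ proj₁) ⟩ u) a → P (A ⊸ ⊥ᴵ) (W u) (a , tt)
    W-at a u a∉Ps = simulates⇒P⊸ A ⊥ᴵ (W u) λ pv (lift v∩W≡∅) →
      a∉Ps (mono A (λ a′ va′ → ∁∁⊆ (⟨ graph (proj₁ ∘′ proj₁) ⟩ u) a′ λ a′∉s →
                                   v∩W≡∅ (a′ , va′ , a′∉s)) a pv)

  bidual-iso : ∀ {A} → IsIso (Int Int-isCategory) (curry⇒ {A} {A ⊸ ⊥ᴵ} (eval⇒ {A} {⊥ᴵ} ∘ swap⇒ {A} {A ⊸ ⊥ᴵ}))
  bidual-iso {A} = record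
    { inv  = simulation⇒arrow bidual-projection-simulation
    ; isoˡ = (λ { _ (_ , (_ , refl , refl , refl) , refl) → refl }) ,
             (λ { (a , _) refl → ((a , tt) , tt) , (((a , tt) , a) , refl , refl , refl) , refl })
    ; isoʳ = (λ { _ (_ , refl , _ , refl , refl , refl) → refl }) ,
             (λ { (((a , tt) , tt) , _) refl → a , refl , ((a , tt) , a) , refl , refl , refl })
    }

  symmetricMonoidalClosed : SymmetricMonoidalClosed (Int Int-isCategory) _⊗_ 𝟏 _⊸_
  symmetricMonoidalClosed = record
    { _⊗₁_ = _⊗⇒_
    ; ⊗-resp-≈ = λ { (f⊆f′ , f′⊆f) (g⊆g′ , g′⊆g) →
        (λ { ((a , x) , (b , y)) (fab , gxy) → f⊆f′ (a , b) fab , g⊆g′ (x , y) gxy }) ,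
        (λ { ((a , x) , (b , y)) (fab , gxy) → f′⊆f (a , b) fab , g′⊆g (x , y) gxy }) }
    ; ⊗-id = (λ { _ (refl , refl) → refl }) , (λ { _ refl → refl , refl })
    ; ⊗-∘ = (λ { _ ((b , fab , gbc) , (y , hxy , kyz)) → (b , y) , (fab , hxy) , (gbc , kyz) }) ,
            (λ { _ ((b , y) , (fab , hxy) , (gbc , kyz)) → (b , fab , gbc) , (y , hxy , kyz) })
    ; α⇒ = λ {A} {B} {C} → assoc⇒ {A} {B} {C}
    ; λ⇒ = unitˡ⇒
    ; ρ⇒ = unitʳ⇒
    ; σ  = λ {A} {B} → swap⇒ {A} {B}
    ; α-iso = λ {A} {B} {C} →
        graph-iso (assocʳ-simulation {A} {B} {C}) (assocˡ-simulation {A} {B} {C}) (λ _ → refl) (λ _ → refl)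
    ; λ-iso = graph-iso unitˡ-simulation unitˡ⁻¹-simulation (λ _ → refl) (λ _ → refl)
    ; ρ-iso = graph-iso unitʳ-simulation unitʳ⁻¹-simulation (λ _ → refl) (λ _ → refl)
    ; σ-invol = λ {A} {B} → graph-inverse {A ⊗ B} {B ⊗ A} swap swap (λ _ → refl)
    ; α-natural = (λ { _ (_ , ((fab , gxy) , hzw) , refl) → _ , refl , fab , gxy , hzw }) ,
                  (λ { _ (_ , refl , fab , gxy , hzw) → _ , ((fab , gxy) , hzw) , refl })
    ; λ-natural = (λ { _ (_ , (refl , fab) , refl) → _ , refl , fab }) ,
                  (λ { ((t , _) , _) (_ , refl , fab) → (t , _) , (refl , fab) , refl })
    ; ρ-natural = (λ { _ (_ , (fab , refl) , refl) → _ , refl , fab }) ,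
                  (λ { ((_ , t) , _) (_ , refl , fab) → (_ , t) , (fab , refl) , refl })
    ; σ-natural = (λ { _ (_ , (fab , gxy) , refl) → _ , refl , gxy , fab }) ,
                  (λ { _ (_ , refl , gxy , fab) → _ , (fab , gxy) , refl })
    ; pentagon = (λ { _ (_ , (_ , (refl , refl) , refl) , refl , refl) → _ , refl , refl }) ,
                 (λ { _ (_ , refl , refl) → _ , (_ , (refl , refl) , refl) , refl , refl })
    ; triangle = (λ { _ (_ , refl , refl , refl) → refl , refl }) ,
                 (λ { _ (refl , refl) → _ , refl , refl , refl })
    ; hexagon = (λ { _ (_ , (_ , refl , refl) , refl) → _ , (_ , (refl , refl) , refl) , refl , refl }) ,
                (λ { _ (_ , (_ , (refl , refl) , refl) , refl , refl) → _ , (_ , refl , refl) , refl })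
    ; ev = λ {B} → eval⇒ {B}
    ; curry = λ {A} {B} → curry⇒ {A} {B}
    ; curry-resp-≈ = λ { (f⊆g , g⊆f) → (λ { _ fabx → f⊆g _ fabx }) , (λ { _ gabx → g⊆f _ gabx }) }
    ; curry-β = (λ { _ (_ , (fabx , refl) , refl , refl) → fabx }) ,
                (λ { ((_ , b) , x) fabx → ((b , x) , b) , (fabx , refl) , refl , refl })
    ; curry-η = (λ { _ (_ , (gabx , refl) , refl , refl) → gabx }) ,
                (λ { (_ , (b , x)) gabx → ((b , x) , b) , (gabx , refl) , refl , refl })
    }

  starAutonomous : StarAutonomous (Int Int-isCategory) _⊗_ 𝟏 _⊸_ ⊥ᴵ
  starAutonomous = record
    { smc = symmetricMonoidalClosed
    ; dualizing = λ {A} → bidual-iso {A}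
    }

proposition3 : ExcludedMiddle 0ℓ → ExcludedMiddle (lsuc 0ℓ) →
    Σ[ H ∈ IntIsCategory ] StarAutonomous (Int H) _⊗_ 𝟏 _⊸_ ⊥ᴵ
proposition3 em₀ em₁ = Int-isCategory , starAutonomous
  where open Classical em₀ em₁
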